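{- Let $R$ be a finite local ring with maximal ideal $\mathfrak m$ and nilpotence degree $k$, and let $E$ be an elliptic curve over $R$. There is a polynomial $f\in R[x]$ of degree strictly less than $k$ such that every $P\in E^\infty$ equals $(P_x:1:f(P_x))$. Moreover, $x^3\mid f(x)$.
   Context: The nilpotence degree of $R$ is the least $k$ with $\mathfrak m^k=0$. An elliptic curve $E$ over $R$ is the set of points of $\mathbb P^2(R)$ (primitive triples modulo multiplication by units) satisfying $y^2z+a_1xyz+a_3yz^2=x^3+a_2x^2z+a_4xz^2+a_6z^3$, $a_i\in R$, with discriminant a unit. $E^\infty$ is the set of points of $E$ whose reduction modulo $\mathfrak m$ is $(0:1:0)$; each such point has a unique representative $(P_x:1:P_z)$ with $P_x,P_z\in\mathfrak m$. -}

module Defs where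

open import Level using (Level; _⊔_)
open import Algebra.Bundles using (CommutativeRing)
open import Data.Nat as ℕ using (ℕ; zero; suc)
open import Data.Vec using (Vec; []; _∷_)
open import Data.List using (List)
open import Data.List.Relation.Unary.Any using (Any)
open import Data.Vec.Relation.Unary.All using (All)
open import Data.Product using (Σ; _×_; ∃)
open import Relation.Nullary using (¬_)

module _ {c ℓ : Level} (R : CommutativeRing c ℓ) where
  open CommutativeRing R

  nat : ℕ → Carrier
  nat zero = 0#
  nat (suc n) = 1# + nat n

  _^_ : Carrier → ℕ → Carrier
  x ^ zero = 1#
  x ^ suc n = x * (x ^ n)

  IsUnit : Carrier → Set (c ⊔ ℓ)
  IsUnit a = Σ Carrier λ b → a * b ≈ 1#

  IsFinite : Set (c ⊔ ℓ)
  IsFinite = Σ (List Carrier) λ xs → ∀ x → Any (x ≈_) xs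

  record IsIdeal {p} (m : Carrier → Set p) : Set (c ⊔ ℓ ⊔ p) where
    field
      resp  : ∀ {x y} → x ≈ y → m x → m y
      zero∈ : m 0#
      +∈    : ∀ {x y} → m x → m y → m (x + y)
      *∈    : ∀ r {x} → m x → m (r * x)

  -- R is a local ring with maximal ideal m: m is a proper ideal and
  -- every element outside m is a unit (so m is the unique maximal ideal)
  record IsLocalWithMaxIdeal {p} (m : Carrier → Set p) : Set (c ⊔ ℓ ⊔ p) where
    field
      ideal    : IsIdeal m
      proper   : ¬ m 1#
      nonUnit  : ∀ x → ¬ m x → IsUnit x

  prod : ∀ {n} → Vec Carrier n → Carrier
  prod [] = 1#
  prod (x ∷ xs) = x * prod xs

  -- m^j = 0 : every product of j elements of m vanishes
  -- (m^j is the ideal generated by such products)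
  PowZero : ∀ {p} → (Carrier → Set p) → ℕ → Set (c ⊔ ℓ ⊔ p)
  PowZero m j = (v : Vec Carrier j) → All m v → prod v ≈ 0#

  IsNilpotenceDegree : ∀ {p} → (Carrier → Set p) → ℕ → Set (c ⊔ ℓ ⊔ p)
  IsNilpotenceDegree m k = PowZero m k × (∀ j → PowZero m j → k ℕ.≤ j)

  record Weierstrass : Set c where
    field a₁ a₂ a₃ a₄ a₆ : Carrier

  module _ (W : Weierstrass) where
    open Weierstrass W
    b₂ b₄ b₆ b₈ Δ : Carrier
    b₂ = a₁ ^ 2 + nat 4 * a₂
    b₄ = nat 2 * a₄ + a₁ * a₃
    b₆ = a₃ ^ 2 + nat 4 * a₆
    b₈ = (a₁ ^ 2) * a₆ + nat 4 * a₂ * a₆ - a₁ * a₃ * a₄ + a₂ * (a₃ ^ 2) - a₄ ^ 2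
    Δ = - (b₂ ^ 2) * b₈ - nat 8 * (b₄ ^ 3) - nat 27 * (b₆ ^ 2) + nat 9 * b₂ * b₄ * b₆

    OnCurve : Carrier → Carrier → Carrier → Set ℓ
    OnCurve X Y Z =
      (Y ^ 2) * Z + a₁ * X * Y * Z + a₃ * Y * (Z ^ 2)
        ≈ X ^ 3 + a₂ * (X ^ 2) * Z + a₄ * X * (Z ^ 2) + a₆ * (Z ^ 3)

  record Triple : Set c where
    constructor ⟨_,_,_⟩
    field X Y Z : Carrier

  open Triple public

  Primitive : Triple → Set (c ⊔ ℓ)
  Primitive P = Σ Carrier λ r → Σ Carrier λ s → Σ Carrier λ t →
    r * X P + s * Y P + t * Z P ≈ 1#

  _≈ℙ_ : Triple → Triple → Set (c ⊔ ℓ)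
  P ≈ℙ Q = Σ Carrier λ u → IsUnit u ×
    (X Q ≈ u * X P × Y Q ≈ u * Y P × Z Q ≈ u * Z P)

  OnE : Weierstrass → Triple → Set (c ⊔ ℓ)
  OnE W P = Primitive P × OnCurve W (X P) (Y P) (Z P)

  -- P ∈ E^∞: P ∈ E and P reduces to (0:1:0) modulo m
  InE∞ : ∀ {p} → (Carrier → Set p) → Weierstrass → Triple → Set (c ⊔ ℓ ⊔ p)
  InE∞ m W P = OnE W P × m (X P) × m (Z P)

  -- polynomials of degree < k as coefficient vectors (constant term first)
  eval : ∀ {n} → Vec Carrier n → Carrier → Carrier
  eval [] x = 0#
  eval (c₀ ∷ cs) x = c₀ + x * eval cs x

  coeff : ∀ {n} → Vec Carrier n → ℕ → Carrier
  coeff [] i = 0#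
  coeff (c₀ ∷ cs) zero = c₀
  coeff (c₀ ∷ cs) (suc i) = coeff cs i

  X³∣ : ∀ {n} → Vec Carrier n → Set ℓ
  X³∣ f = ∀ i → i ℕ.< 3 → coeff f i ≈ 0#

-- A point of E^∞ has coprime coordinates with X, Z ∈ 𝔪, so Y is a unit and the point is (x : 1 : z)
-- with x, z ∈ 𝔪; the Weierstrass equation at Y = 1 reads z = F(x, z), where
-- F(x, z) = x³ + a₂x²z + a₄xz² + a₆z³ − a₁xz − a₃z². Since
-- F(x, z) − F(x, w) = (z − w) H(x, z, w) with H(x, z, w) ∈ 𝔪 whenever x, z, w ∈ 𝔪, every
-- step of the iteration w ↦ F(x, w) started at 0 multiplies the error z − w by an element
-- of 𝔪; after k steps the error lies in 𝔪ᵏ = 0, so z is the k-th iterate. That iterate is a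
-- polynomial in x, divisible by x³ because x³ is the only term of F free of z, and cutting
-- it off below degree k does not change its values on 𝔪 since xᵏ = 0 there.
module Submission where

open import Defs
open import Level using (Level; _⊔_)
open import Algebra.Bundles using (CommutativeRing)
open import Data.Nat as ℕ using (ℕ; zero; suc; s≤s)
open import Data.Nat.Properties using (<⇒≤)
open import Data.Nat.GeneralisedArithmetic using (fold)
open import Data.List using (List; []; _∷_; map; drop)
open import Data.List.Properties using (drop-[])
open import Data.Vec using (Vec; []; _∷_; replicate; fromList)
open import Data.Vec.Relation.Unary.All using (All; []; _∷_)
open import Data.Product using (Σ; _×_; _,_)
open import Relation.Nullary using (¬_)
import Relation.Binary.PropositionalEquality as ≡

module _ {c ℓ : Level} (R : CommutativeRing c ℓ) where
  open CommutativeRing R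
  open import Algebra.Properties.Group +-group using (x∙y⁻¹≈ε⇒x≈y)
  open import Algebra.Properties.Ring ring using ([y-z]x≈yx-zx)
  -- Identities are proved by the semiring solver with negated elements treated as
  -- atoms; the few cancellations x - x ≈ 0 that are needed are done by hand.
  open import Algebra.Solver.Ring.NaturalCoefficients.Default commutativeSemiring
    using (solve; _:=_; _:+_; _:*_; con)
  open import Relation.Binary.Reasoning.Setoid setoid

  x+w≈y+z⇒x-y≈z-w : ∀ {x y z w} → x + w ≈ y + z → x - y ≈ z - w
  x+w≈y+z⇒x-y≈z-w {x} {y} {z} {w} eq = begin
    x - y               ≈⟨ +-identityʳ (x - y) ⟨
    (x - y) + 0#        ≈⟨ +-congˡ (-‿inverseʳ w) ⟨
    (x - y) + (w - w)   ≈⟨ solve 4 (λ x y′ w w′ → x :+ y′ :+ (w :+ w′) := x :+ w :+ (y′ :+ w′))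
                             refl x (- y) w (- w) ⟩
    (x + w) + (- y - w) ≈⟨ +-congʳ eq ⟩
    (y + z) + (- y - w) ≈⟨ solve 4 (λ y z y′ w′ → y :+ z :+ (y′ :+ w′) := y :+ y′ :+ (z :+ w′))
                             refl y z (- y) (- w) ⟩
    (y - y) + (z - w)   ≈⟨ +-congʳ (-‿inverseʳ y) ⟩
    0# + (z - w)        ≈⟨ +-identityˡ (z - w) ⟩
    z - w               ∎

  x+w*h≈y+z*h⇒x-y≈[z-w]*h : ∀ {x y z w h} → x + w * h ≈ y + z * h → x - y ≈ (z - w) * h
  x+w*h≈y+z*h⇒x-y≈[z-w]*h {z = z} {w} {h} eq =
    trans (x+w≈y+z⇒x-y≈z-w eq) (sym ([y-z]x≈yx-zx h z w))

  PowZero⇒x^n≈0 : ∀ {p} {m : Carrier → Set p} {n x} → PowZero R m n → m x → _^_ R x n ≈ 0#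
  PowZero⇒x^n≈0 {m = m} {n} {x} mⁿ≈0 mx =
    trans (sym (prod-replicate n)) (mⁿ≈0 (replicate n x) (All-replicate n))
    where
    prod-replicate : ∀ n → prod R (replicate n x) ≈ _^_ R x n
    prod-replicate zero    = refl
    prod-replicate (suc n) = *-congˡ (prod-replicate n)
    All-replicate : ∀ n → All m (replicate n x)
    All-replicate zero    = []
    All-replicate (suc n) = mx ∷ All-replicate n

  module _ {p} (m : Carrier → Set p) (φ : Carrier → Carrier)
    (φ-resp-m : ∀ {w} → m w → m (φ w))
    (φ-contracts : ∀ {z w} → m z → m w → Σ Carrier λ h → m h × φ z - φ w ≈ (z - w) * h)
    {z : Carrier} (mz : m z) (z≈φz : z ≈ φ z) where

    fold-resp-m : ∀ {w} → m w → ∀ i → m (fold w φ i)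
    fold-resp-m mw zero    = mw
    fold-resp-m mw (suc i) = φ-resp-m (fold-resp-m mw i)

    fold-error : ∀ {w} → m w → ∀ i →
      Σ (Vec Carrier i) λ v → All m v × z - fold w φ i ≈ (z - w) * prod R v
    fold-error {w} mw zero = [] , [] , sym (*-identityʳ (z - w))
    fold-error {w} mw (suc i) with fold-error mw i | φ-contracts mz (fold-resp-m mw i)
    ... | v , mv , error | h , mh , contraction = h ∷ v , mh ∷ mv , (begin
      z - φ wᵢ               ≈⟨ +-congʳ z≈φz ⟩
      φ z - φ wᵢ             ≈⟨ contraction ⟩
      (z - wᵢ) * h           ≈⟨ *-congʳ error ⟩
      (z - w) * prod R v * h ≈⟨ solve 3 (λ e q h → e :* q :* h := e :* (h :* q)) refl (z - w) (prod R v) h ⟩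
      (z - w) * (h * prod R v) ∎)
      where wᵢ = fold w φ i

    fold-reaches-fixed-point : ∀ {k w} → PowZero R m k → m w → z ≈ fold w φ k
    fold-reaches-fixed-point {k} {w} mᵏ≈0 mw with fold-error mw k
    ... | v , mv , error = x∙y⁻¹≈ε⇒x≈y z (fold w φ k)
      (trans error (trans (*-congˡ (mᵏ≈0 v mv)) (zeroʳ (z - w))))

  -- Polynomials are coefficient lists, constant term first; going through fromList lets
  -- eval and coeff of Defs act on them.
  Poly : Set c
  Poly = List Carrier

  evalₚ : Poly → Carrier → Carrier
  evalₚ p = eval R (fromList p)

  X^_∣_ : ℕ → Poly → Set ℓ
  X^ j ∣ p = ∀ i → i ℕ.< j → coeff R (fromList p) i ≈ 0#

  infixl 6 _+ₚ_
  infixl 7 _*ₚ_ _·ₚ_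

  _+ₚ_ : Poly → Poly → Poly
  []      +ₚ q       = q
  (a ∷ p) +ₚ []      = a ∷ p
  (a ∷ p) +ₚ (b ∷ q) = a + b ∷ p +ₚ q

  _·ₚ_ : Carrier → Poly → Poly
  a ·ₚ p = map (a *_) p

  _*ₚ_ : Poly → Poly → Poly
  []      *ₚ q = []
  (a ∷ p) *ₚ q = a ·ₚ q +ₚ (0# ∷ p *ₚ q)

  module _ (x : Carrier) where

    evalₚ-+ₚ : ∀ p q → evalₚ (p +ₚ q) x ≈ evalₚ p x + evalₚ q x
    evalₚ-+ₚ []      q       = sym (+-identityˡ _)
    evalₚ-+ₚ (a ∷ p) []      = sym (+-identityʳ _)
    evalₚ-+ₚ (a ∷ p) (b ∷ q) = trans (+-congˡ (*-congˡ (evalₚ-+ₚ p q)))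
      (solve 5 (λ a b x p q → a :+ b :+ x :* (p :+ q) := a :+ x :* p :+ (b :+ x :* q))
        refl a b x (evalₚ p x) (evalₚ q x))

    evalₚ-·ₚ : ∀ a p → evalₚ (a ·ₚ p) x ≈ a * evalₚ p x
    evalₚ-·ₚ a []      = sym (zeroʳ a)
    evalₚ-·ₚ a (b ∷ p) = trans (+-congˡ (*-congˡ (evalₚ-·ₚ a p)))
      (solve 4 (λ a b x p → a :* b :+ x :* (a :* p) := a :* (b :+ x :* p)) refl a b x (evalₚ p x))

    evalₚ-*ₚ : ∀ p q → evalₚ (p *ₚ q) x ≈ evalₚ p x * evalₚ q x
    evalₚ-*ₚ []      q = sym (zeroˡ _)
    evalₚ-*ₚ (a ∷ p) q = begin
      evalₚ (a ·ₚ q +ₚ (0# ∷ p *ₚ q)) x               ≈⟨ evalₚ-+ₚ (a ·ₚ q) (0# ∷ p *ₚ q) ⟩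
      evalₚ (a ·ₚ q) x + (0# + x * evalₚ (p *ₚ q) x) ≈⟨ +-cong (evalₚ-·ₚ a q) (+-congˡ (*-congˡ (evalₚ-*ₚ p q))) ⟩
      a * Q + (0# + x * (evalₚ p x * Q))             ≈⟨ solve 4 (λ a x p q → a :* q :+ (con 0 :+ x :* (p :* q)) := (a :+ x :* p) :* q)
                                                         refl a x (evalₚ p x) Q ⟩
      (a + x * evalₚ p x) * Q                        ∎
      where Q = evalₚ q x

  X^∣-tail : ∀ {j a p} → X^ suc j ∣ (a ∷ p) → X^ j ∣ p
  X^∣-tail d i i<j = d (suc i) (s≤s i<j)

  X^∣-[] : ∀ {j} → X^ j ∣ []
  X^∣-[] i i<j = refl

  X^∣-0∷ : ∀ {j p} → X^ j ∣ p → X^ j ∣ (0# ∷ p)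
  X^∣-0∷ dp zero    0<j = refl
  X^∣-0∷ dp (suc i) i<j = dp i (<⇒≤ i<j)

  X^∣-+ₚ : ∀ {j} p q → X^ j ∣ p → X^ j ∣ q → X^ j ∣ (p +ₚ q)
  X^∣-+ₚ []      q       dp dq = dq
  X^∣-+ₚ (a ∷ p) []      dp dq = dp
  X^∣-+ₚ (a ∷ p) (b ∷ q) dp dq zero    0<j       = trans (+-cong (dp 0 0<j) (dq 0 0<j)) (+-identityʳ 0#)
  X^∣-+ₚ (a ∷ p) (b ∷ q) dp dq (suc i) (s≤s i<j) = X^∣-+ₚ p q (X^∣-tail dp) (X^∣-tail dq) i i<j

  X^∣-·ₚ : ∀ {j} a p → X^ j ∣ p → X^ j ∣ (a ·ₚ p)
  X^∣-·ₚ a []      dp = X^∣-[]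
  X^∣-·ₚ a (b ∷ p) dp zero    0<j       = trans (*-congˡ (dp 0 0<j)) (zeroʳ a)
  X^∣-·ₚ a (b ∷ p) dp (suc i) (s≤s i<j) = X^∣-·ₚ a p (X^∣-tail dp) i i<j

  X^∣-*ₚ : ∀ {j} p q → X^ j ∣ q → X^ j ∣ (p *ₚ q)
  X^∣-*ₚ []      q dq = X^∣-[]
  X^∣-*ₚ (a ∷ p) q dq =
    X^∣-+ₚ (a ·ₚ q) (0# ∷ p *ₚ q) (X^∣-·ₚ a q dq) (X^∣-0∷ (X^∣-*ₚ p q dq))

  record PolyFun (j : ℕ) (g : Carrier → Carrier) : Set (c ⊔ ℓ) where
    field
      poly      : Poly
      divisible : X^ j ∣ poly
      evaluates : ∀ x → evalₚ poly x ≈ g x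

  open PolyFun

  zeroᶠ : ∀ {j} → PolyFun j (λ _ → 0#)
  zeroᶠ = record { poly = [] ; divisible = X^∣-[] ; evaluates = λ _ → refl }

  constᶠ : ∀ a → PolyFun 0 (λ _ → a)
  constᶠ a = record
    { poly      = a ∷ []
    ; divisible = λ _ ()
    ; evaluates = λ x → solve 2 (λ a x → a :+ x :* con 0 := a) refl a x
    }

  idᶠ : PolyFun 0 (λ x → x)
  idᶠ = record
    { poly      = 0# ∷ 1# ∷ []
    ; divisible = λ _ ()
    ; evaluates = λ x → solve 1 (λ x → con 0 :+ x :* (con 1 :+ x :* con 0) := x) refl x
    }

  cubeᶠ : PolyFun 3 (λ x → x * x * x)
  cubeᶠ = record
    { poly      = 0# ∷ 0# ∷ 0# ∷ 1# ∷ []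
    ; divisible = λ { 0 _ → refl ; 1 _ → refl ; 2 _ → refl ; (suc (suc (suc _))) (s≤s (s≤s (s≤s ()))) }
    ; evaluates = λ x → solve 1 (λ x → con 0 :+ x :* (con 0 :+ x :* (con 0 :+ x :* (con 1 :+ x :* con 0)))
                                        := x :* x :* x) refl x
    }

  infixl 6 _+ᶠ_
  infixl 7 _*ᶠ_

  _+ᶠ_ : ∀ {j g h} → PolyFun j g → PolyFun j h → PolyFun j (λ x → g x + h x)
  G +ᶠ H = record
    { poly      = poly G +ₚ poly H
    ; divisible = X^∣-+ₚ (poly G) (poly H) (divisible G) (divisible H)
    ; evaluates = λ x → trans (evalₚ-+ₚ x (poly G) (poly H)) (+-cong (evaluates G x) (evaluates H x))
    }

  _*ᶠ_ : ∀ {i j g h} → PolyFun i g → PolyFun j h → PolyFun j (λ x → g x * h x)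
  G *ᶠ H = record
    { poly      = poly G *ₚ poly H
    ; divisible = X^∣-*ₚ (poly G) (poly H) (divisible H)
    ; evaluates = λ x → trans (evalₚ-*ₚ x (poly G) (poly H)) (*-cong (evaluates G x) (evaluates H x))
    }

  truncate : ∀ k → Poly → Vec Carrier k
  truncate zero    p       = []
  truncate (suc k) []      = 0# ∷ truncate k []
  truncate (suc k) (a ∷ p) = a ∷ truncate k p

  eval-truncate+X^k*drop : ∀ k p x →
    eval R (truncate k p) x + _^_ R x k * evalₚ (drop k p) x ≈ evalₚ p x
  eval-truncate+X^k*drop zero p x = solve 1 (λ e → con 0 :+ con 1 :* e := e) refl (evalₚ p x)
  eval-truncate+X^k*drop (suc k) [] x = begin
    0# + x * t + x * xᵏ * 0#           ≈⟨ solve 3 (λ x t xᵏ → con 0 :+ x :* t :+ x :* xᵏ :* con 0 := x :* (t :+ xᵏ :* con 0))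
                                            refl x t xᵏ ⟩
    x * (t + xᵏ * 0#)                  ≈⟨ *-congˡ (+-congˡ (*-congˡ (reflexive (≡.cong (λ r → evalₚ r x) (drop-[] k))))) ⟨
    x * (t + xᵏ * evalₚ (drop k []) x) ≈⟨ *-congˡ (eval-truncate+X^k*drop k [] x) ⟩
    x * 0#                             ≈⟨ zeroʳ x ⟩
    0#                                 ∎
    where t = eval R (truncate k []) x ; xᵏ = _^_ R x k
  eval-truncate+X^k*drop (suc k) (a ∷ p) x = begin
    a + x * t + x * xᵏ * d ≈⟨ solve 5 (λ a x t xᵏ d → a :+ x :* t :+ x :* xᵏ :* d := a :+ x :* (t :+ xᵏ :* d))
                                refl a x t xᵏ d ⟩
    a + x * (t + xᵏ * d)   ≈⟨ +-congˡ (*-congˡ (eval-truncate+X^k*drop k p x)) ⟩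
    a + x * evalₚ p x      ∎
    where t = eval R (truncate k p) x ; xᵏ = _^_ R x k ; d = evalₚ (drop k p) x

  eval-truncate : ∀ k p {x} → _^_ R x k ≈ 0# → eval R (truncate k p) x ≈ evalₚ p x
  eval-truncate k p {x} xᵏ≈0 = begin
    t                                       ≈⟨ +-identityʳ t ⟨
    t + 0#                                  ≈⟨ +-congˡ (trans (*-congʳ xᵏ≈0) (zeroˡ _)) ⟨
    t + _^_ R x k * evalₚ (drop k p) x      ≈⟨ eval-truncate+X^k*drop k p x ⟩
    evalₚ p x                               ∎
    where t = eval R (truncate k p) x

  coeff-truncate : ∀ {j} k p → X^ j ∣ p → ∀ i → i ℕ.< j → coeff R (truncate k p) i ≈ 0#
  coeff-truncate zero    p       dp i       i<j       = refl
  coeff-truncate (suc k) []      dp zero    0<j       = refl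
  coeff-truncate (suc k) []      dp (suc i) (s≤s i<j) = coeff-truncate k [] X^∣-[] i i<j
  coeff-truncate (suc k) (a ∷ p) dp zero    0<j       = dp 0 0<j
  coeff-truncate (suc k) (a ∷ p) dp (suc i) (s≤s i<j) = coeff-truncate k p (X^∣-tail dp) i i<j

  module _ (W : Weierstrass R) where
    open Weierstrass W

    cubic : Carrier → Carrier → Carrier
    cubic x z = x * x * x + a₂ * x * x * z + a₄ * x * z * z + a₆ * z * z * z

    F : Carrier → Carrier → Carrier
    F x z = cubic x z + - a₁ * x * z + - a₃ * z * z

    H : Carrier → Carrier → Carrier → Carrier
    H x z w = a₂ * x * x + a₄ * x * z + a₄ * x * w + a₆ * z * z + a₆ * z * w + a₆ * w * w
              + - a₁ * x + - a₃ * z + - a₃ * w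

    F-difference : ∀ x z w → F x z - F x w ≈ (z - w) * H x z w
    F-difference x z w = x+w*h≈y+z*h⇒x-y≈[z-w]*h (solve 8 (λ x z w a₂ a₄ a₆ b₁ b₃ →
      let F′ = λ z → x :* x :* x :+ a₂ :* x :* x :* z :+ a₄ :* x :* z :* z :+ a₆ :* z :* z :* z
                     :+ b₁ :* x :* z :+ b₃ :* z :* z
          H′ = a₂ :* x :* x :+ a₄ :* x :* z :+ a₄ :* x :* w :+ a₆ :* z :* z :+ a₆ :* z :* w
               :+ a₆ :* w :* w :+ b₁ :* x :+ b₃ :* z :+ b₃ :* w
      in F′ z :+ w :* H′ := F′ w :+ z :* H′) refl x z w a₂ a₄ a₆ (- a₁) (- a₃))

    affine-equation : ∀ {X Y Z u} → OnCurve R W X Y Z → u * Y ≈ 1# →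
      u * Z + a₁ * (u * X) * (u * Z) + a₃ * (u * Z) * (u * Z) ≈ cubic (u * X) (u * Z)
    affine-equation {X} {Y} {Z} {u} onCurve uY≈1 = begin
      z + a₁ * x * z + a₃ * z * z
        ≈⟨ solve 4 (λ x z a₁ a₃ → z :+ a₁ :* x :* z :+ a₃ :* z :* z
                     := con 1 :* con 1 :* z :+ a₁ :* x :* con 1 :* z :+ a₃ :* con 1 :* z :* z)
             refl x z a₁ a₃ ⟩
      E 1#
        ≈⟨ E-cong (sym uY≈1) ⟩
      E (u * Y)
        ≈⟨ solve 6 (λ u X Y Z a₁ a₃ →
             u :* Y :* (u :* Y) :* (u :* Z) :+ a₁ :* (u :* X) :* (u :* Y) :* (u :* Z)
               :+ a₃ :* (u :* Y) :* (u :* Z) :* (u :* Z)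
             := u :* u :* u :* (Y :* (Y :* con 1) :* Z :+ a₁ :* X :* Y :* Z :+ a₃ :* Y :* (Z :* (Z :* con 1))))
             refl u X Y Z a₁ a₃ ⟩
      u * u * u * (_^_ R Y 2 * Z + a₁ * X * Y * Z + a₃ * Y * _^_ R Z 2)
        ≈⟨ *-congˡ onCurve ⟩
      u * u * u * (_^_ R X 3 + a₂ * _^_ R X 2 * Z + a₄ * X * _^_ R Z 2 + a₆ * _^_ R Z 3)
        ≈⟨ solve 6 (λ u X Z a₂ a₄ a₆ →
             u :* u :* u :* (X :* (X :* (X :* con 1)) :+ a₂ :* (X :* (X :* con 1)) :* Z
               :+ a₄ :* X :* (Z :* (Z :* con 1)) :+ a₆ :* (Z :* (Z :* (Z :* con 1))))
             := (u :* X) :* (u :* X) :* (u :* X) :+ a₂ :* (u :* X) :* (u :* X) :* (u :* Z)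
               :+ a₄ :* (u :* X) :* (u :* Z) :* (u :* Z) :+ a₆ :* (u :* Z) :* (u :* Z) :* (u :* Z))
             refl u X Z a₂ a₄ a₆ ⟩
      cubic x z
        ∎
      where
      x = u * X
      z = u * Z
      E : Carrier → Carrier
      E y = y * y * z + a₁ * x * y * z + a₃ * y * z * z
      E-cong : ∀ {y y′} → y ≈ y′ → E y ≈ E y′
      E-cong e = +-cong (+-cong (*-congʳ (*-cong e e)) (*-congʳ (*-congˡ e))) (*-congʳ (*-congʳ (*-congˡ e)))

    affine-equation⇒z≈F : ∀ {x z} → z + a₁ * x * z + a₃ * z * z ≈ cubic x z → z ≈ F x z
    affine-equation⇒z≈F {x} {z} eq = begin
      z                                             ≈⟨ solve 3 (λ z xz zz → z := z :+ con 0 :* xz :+ con 0 :* zz)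
                                                         refl z (x * z) (z * z) ⟩
      z + 0# * (x * z) + 0# * (z * z)               ≈⟨ +-cong (+-congˡ (*-congʳ (-‿inverseʳ a₁))) (*-congʳ (-‿inverseʳ a₃)) ⟨
      z + (a₁ - a₁) * (x * z) + (a₃ - a₃) * (z * z) ≈⟨ solve 6 (λ z x a₁ b₁ a₃ b₃ →
                                                           z :+ (a₁ :+ b₁) :* (x :* z) :+ (a₃ :+ b₃) :* (z :* z)
                                                           := z :+ a₁ :* x :* z :+ a₃ :* z :* z :+ b₁ :* x :* z :+ b₃ :* z :* z)
                                                         refl z x a₁ (- a₁) a₃ (- a₃) ⟩
      z + a₁ * x * z + a₃ * z * z + - a₁ * x * z + - a₃ * z * z ≈⟨ +-congʳ (+-congʳ eq) ⟩
      F x z                                         ∎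

    F-polynomial : ∀ {g} → PolyFun 3 g → PolyFun 3 (λ x → F x (g x))
    F-polynomial G = cubeᶠ
      +ᶠ constᶠ a₂ *ᶠ idᶠ *ᶠ idᶠ *ᶠ G
      +ᶠ constᶠ a₄ *ᶠ idᶠ *ᶠ G *ᶠ G
      +ᶠ constᶠ a₆ *ᶠ G *ᶠ G *ᶠ G
      +ᶠ constᶠ (- a₁) *ᶠ idᶠ *ᶠ G
      +ᶠ constᶠ (- a₃) *ᶠ G *ᶠ G

    picard : ℕ → Carrier → Carrier
    picard i x = fold 0# (F x) i

    picard-polynomial : ∀ i → PolyFun 3 (picard i)
    picard-polynomial zero    = zeroᶠ
    picard-polynomial (suc i) = F-polynomial (picard-polynomial i)

    module _ {p} {m : Carrier → Set p} (ideal : IsIdeal R m) where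
      open IsIdeal ideal

      F-resp-m : ∀ {x z} → m x → m z → m (F x z)
      F-resp-m mx mz = +∈ (+∈ (+∈ (+∈ (+∈ (*∈ _ mx) (*∈ _ mz)) (*∈ _ mz)) (*∈ _ mz)) (*∈ _ mz)) (*∈ _ mz)

      H-resp-m : ∀ {x z w} → m x → m z → m w → m (H x z w)
      H-resp-m mx mz mw = +∈ (+∈ (+∈ (+∈ (+∈ (+∈ (+∈ (+∈ (*∈ _ mx) (*∈ _ mz)) (*∈ _ mw))
        (*∈ _ mz)) (*∈ _ mw)) (*∈ _ mw)) (*∈ _ mx)) (*∈ _ mz)) (*∈ _ mw)

      z≈F⇒z≈picard : ∀ {k x z} → PowZero R m k → m x → m z → z ≈ F x z → z ≈ picard k x
      z≈F⇒z≈picard {x = x} mᵏ≈0 mx mz z≈Fxz =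
        fold-reaches-fixed-point m (F x) (F-resp-m mx)
          (λ {z} {w} mz mw → H x z w , H-resp-m mx mz mw , F-difference x z w)
          mz z≈Fxz mᵏ≈0 zero∈

      z≈F⇒z≈truncated-picard : ∀ {k x z} → PowZero R m k → m x → m z → z ≈ F x z →
        eval R (truncate k (poly (picard-polynomial k))) x ≈ z
      z≈F⇒z≈truncated-picard {k} {x} {z} mᵏ≈0 mx mz z≈Fxz = begin
        eval R (truncate k (poly Pₖ)) x ≈⟨ eval-truncate k (poly Pₖ) (PowZero⇒x^n≈0 mᵏ≈0 mx) ⟩
        evalₚ (poly Pₖ) x                ≈⟨ evaluates Pₖ x ⟩
        picard k x                       ≈⟨ z≈F⇒z≈picard mᵏ≈0 mx mz z≈Fxz ⟨
        z                                ∎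
        where Pₖ = picard-polynomial k

    module _ {p} {m : Carrier → Set p} (local : IsLocalWithMaxIdeal R m) where
      open IsLocalWithMaxIdeal local
      open IsIdeal ideal

      InE∞⇒Y-invertible : ∀ {P} → InE∞ R m W P → Σ Carrier λ u → u * Y P ≈ 1#
      InE∞⇒Y-invertible {⟨ X , Y , Z ⟩} (((r , s , t , comb≈1) , _) , mX , mZ)
        with nonUnit Y Y∉m
        where
        Y∉m : ¬ m Y
        Y∉m mY = proper (resp comb≈1 (+∈ (+∈ (*∈ r mX) (*∈ s mY)) (*∈ t mZ)))
      ... | u , Yu≈1 = u , trans (*-comm u Y) Yu≈1

      InE∞⇒on-graph : ∀ {n} (f : Vec Carrier n) →
        (∀ {x z} → m x → m z → z ≈ F x z → eval R f x ≈ z) →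
        ∀ P → InE∞ R m W P → Σ Carrier λ x → _≈ℙ_ R P ⟨ x , 1# , eval R f x ⟩
      InE∞⇒on-graph f solves P@(⟨ X , Y , Z ⟩) P∈E∞@((_ , onCurve) , mX , mZ)
        with InE∞⇒Y-invertible {P} P∈E∞
      ... | u , uY≈1 = u * X , u , (Y , uY≈1) , refl , sym uY≈1 ,
        solves (*∈ u mX) (*∈ u mZ) (affine-equation⇒z≈F (affine-equation onCurve uY≈1))

mainTheorem5 : {c ℓ p : Level} (R : CommutativeRing c ℓ) →
    IsFinite R →
    (m : CommutativeRing.Carrier R → Set p) → IsLocalWithMaxIdeal R m →
    (k : ℕ) → IsNilpotenceDegree R m k →
    (W : Weierstrass R) → IsUnit R (Δ R W) →
    Σ (Vec (CommutativeRing.Carrier R) k) λ f →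
      ((P : Triple R) → InE∞ R m W P →
        Σ (CommutativeRing.Carrier R) λ px →
          _≈ℙ_ R P ⟨ px , CommutativeRing.1# R , eval R f px ⟩)
      × X³∣ R f
mainTheorem5 R _ m local k (mᵏ≈0 , _) W _ =
  f ,
  InE∞⇒on-graph R W local f (z≈F⇒z≈truncated-picard R W (IsLocalWithMaxIdeal.ideal local) mᵏ≈0) ,
  coeff-truncate R k (PolyFun.poly Pₖ) (PolyFun.divisible Pₖ)
  where
  Pₖ = picard-polynomial R W k
  f  = truncate R k (PolyFun.poly Pₖ)
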